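{- Let $f:\{0,1,2\}^*\to\{0,1,2\}^*$ be the morphism $0\mapsto 012$, $1\mapsto 112002$, $2\mapsto\varepsilon$, and let $\mathbf{x}=f^\omega(0)$ be its fixed point starting with $0$. Then the additive complexity of $\mathbf{x}$ is the ultimately periodic sequence $134(355)^\omega$, i.e., $\rho^{\mathrm{add}}_{\mathbf{x}}(0)=1$, $\rho^{\mathrm{add}}_{\mathbf{x}}(1)=3$, $\rho^{\mathrm{add}}_{\mathbf{x}}(2)=4$, and for $n\ge 3$, $\rho^{\mathrm{add}}_{\mathbf{x}}(n)=3$ if $n\equiv 0\pmod 3$ and $\rho^{\mathrm{add}}_{\mathbf{x}}(n)=5$ otherwise.
   Context: Letters $0,1,2$ are regarded as integers. Words $u,v$ are additively equivalent if $|u|=|v|$ and $|u|_1+2|u|_2=|v|_1+2|v|_2$, where $|w|_a$ counts occurrences of $a$ in $w$. $\rho^{\mathrm{add}}_{\mathbf{x}}(n)$ is the number of additive equivalence classes of length-$n$ factors of $\mathbf{x}$. $\varepsilon$ denotes the empty word. -}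

module Defs where

open import Data.Nat using (ℕ; zero; suc; _+_; _*_)
open import Data.Fin using (Fin; toℕ) renaming (zero to f0; suc to fs)
open import Data.List using (List; []; _∷_; map; concatMap; length; upTo)
open import Data.Nat.ListAction using (sum)
open import Data.List.Relation.Unary.All using (All)
open import Data.List.Relation.Unary.Any using (Any)
open import Data.List.Relation.Unary.AllPairs using (AllPairs)
open import Data.Product using (Σ; _×_; ∃)
open import Relation.Binary.PropositionalEquality using (_≡_)
open import Relation.Nullary using (¬_)

Letter : Set
Letter = Fin 3

l0 l1 l2 : Letter
l0 = f0
l1 = fs f0
l2 = fs (fs f0)

Word : Set
Word = List Letter

f : Letter → Word
f f0 = l0 ∷ l1 ∷ l2 ∷ []
f (fs f0) = l1 ∷ l1 ∷ l2 ∷ l0 ∷ l0 ∷ l2 ∷ []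
f (fs (fs f0)) = []

f* : Word → Word
f* = concatMap f

fpow : ℕ → Word
fpow zero = l0 ∷ []
fpow (suc k) = f* (fpow k)

-- i-th letter of a word (default 0 if out of range)
at : Word → ℕ → Letter
at [] _ = l0
at (a ∷ w) zero = a
at (a ∷ w) (suc i) = at w i

-- The fixed point x = f^ω(0): its i-th letter is the i-th letter of f^(i+1)(0)
-- (f^k(0) is a prefix of f^(k+1)(0) and |f^(i+1)(0)| > i).
x : ℕ → Letter
x i = at (fpow (suc i)) i

factor : (ℕ → Letter) → ℕ → ℕ → Word
factor y i n = map (λ j → y (i + j)) (upTo n)

IsFactor : (ℕ → Letter) → Word → Set
IsFactor y w = ∃ λ i → w ≡ factor y i (length w)

weight : Word → ℕ
weight w = sum (map toℕ w)

AddEq : Word → Word → Set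
AddEq u v = (length u ≡ length v) × (weight u ≡ weight v)

-- ρ^add_y(n) = k : there is a list R of k length-n factors of y, pairwise
-- additively inequivalent, such that every length-n factor of y is
-- additively equivalent to a member of R (R is a system of representatives
-- of the additive classes of length-n factors).
RhoAdd : (ℕ → Letter) → ℕ → ℕ → Set
RhoAdd y n k =
  Σ (List Word) λ R →
    (length R ≡ k)
    × All (λ u → length u ≡ n) R
    × All (IsFactor y) R
    × AllPairs (λ u v → ¬ AddEq u v) R
    × (∀ w → length w ≡ n → IsFactor y w → Any (AddEq w) R)

-- Cut x into blocks of three letters, A = 012, B = 112 and C = 002. Then x spells out the
-- fixed point b = ABCBCBCAA… of the 3-uniform morphism σ : A ↦ ABC, B ↦ BCB, C ↦ CAA,
-- since f maps A to ABC and the pair BC (B is always followed by C) to BCB·CAA.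
-- The partial sums of x_i − 1 stay in a window of width 2: with the potential read off
-- blockwise, weight x[i, i+n) = n + potential (i + n) − potential i and the potential is in
-- {0, 1, 2}. So the weights of length-n factors lie in [n − 2, n + 2], and in [n − 1, n + 1]
-- when 3 ∣ n, as then both ends sit at the same offset inside their blocks. Conversely,
-- A and C are followed by every block at every distance ≥ 2 in b (checked on σ⁴(A) up to
-- distance 5, then propagated by σ), which yields a factor of every weight in the window.
-- Length 2 is special only in that 22 never occurs.
module Submission where

open import Data.Nat using (ℕ; _≤_; _%_)
open import Data.Product using (_×_)
open import Relation.Binary.PropositionalEquality using (_≡_)
open import Relation.Nullary using (¬_)

open import Defs
open import Data.Fin using (Fin; toℕ)
open import Data.Fin.Patterns using (0F; 1F; 2F)
open import Data.Fin.Properties using (toℕ<n; toℕ-injective; toℕ-fromℕ<; all?)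
open import Data.List using (List; []; _∷_; _++_; map; concatMap; length; tabulate; upTo; applyUpTo)
open import Data.List.Membership.Propositional using (_∈_)
open import Data.List.Membership.Propositional.Properties using (∈-map⁺; ∈-upTo⁺)
open import Data.List.Properties using (concatMap-++; map-applyUpTo; map-upTo; map-cong; length-map; length-upTo)
open import Data.List.Relation.Unary.All using (All; []; _∷_)
import Data.List.Relation.Unary.All as All
import Data.List.Relation.Unary.All.Properties as All
open import Data.List.Relation.Unary.Any using (Any; here)
import Data.List.Relation.Unary.Any as Any
import Data.List.Relation.Unary.Any.Properties as Any
import Data.List.Relation.Unary.AllPairs as AllPairs
import Data.List.Relation.Unary.AllPairs.Properties as AllPairs
open import Data.List.Relation.Unary.Linked using (Linked; []; [-]; _∷_)
open import Data.List.Relation.Unary.Unique.Propositional using (Unique)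
import Data.List.Relation.Unary.Unique.Propositional.Properties as Unique
open import Data.Nat using (zero; suc; _+_; _*_; _∸_; _<_; z≤n; s≤s; s≤s⁻¹)
open import Data.Nat.DivMod using (_/_; _mod_; _divMod_; result; +-distrib-/-∣ʳ; m<n⇒m/n≡0; m*n/n≡m; [m+kn]%n≡m%n; m<n⇒m%n≡m)
open import Data.Nat.Divisibility using (n∣m*n)
open import Data.Nat.Induction using (<-rec)
open import Data.Nat.Properties
  using ( +-assoc; +-comm; +-identityʳ; +-suc; *-suc; *-comm; +-cancelˡ-≡; +-cancelʳ-≡
        ; ≤-refl; ≤-trans; <-trans; ≤-<-trans; <-≤-trans; ≤-total; <⇒≱; n<1+n
        ; m≤m+n; m≤n+m; m≤m*n; m<m*n; +-mono-≤; +-monoʳ-≤; +-monoˡ-<; +-mono-<-≤; *-monoˡ-≤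
        ; m∸n+n≡m; m+n∸n≡m; ∸-monoˡ-<; _≤?_; _<?_; anyUpTo?; allUpTo?; module ≤-Reasoning)
open import Data.Nat.Tactic.RingSolver using (solve-∀)
open import Data.Product using (∃; _,_; proj₁; proj₂)
open import Data.Sum using (inj₁; inj₂)
open import Function using (_∘_)
open import Relation.Binary.Definitions using (DecidableEquality)
open import Relation.Binary.PropositionalEquality using (refl; sym; trans; cong; cong₂; subst; subst₂; module ≡-Reasoning)
open import Relation.Nullary using (contradiction)
open import Relation.Nullary.Decidable using (Dec; yes; no; True; toWitness; map′; _×-dec_; _→-dec_)

nth : {A : Set} → A → List A → ℕ → A
nth a []      _       = a
nth a (c ∷ w) zero    = c
nth a (c ∷ w) (suc i) = nth a w i

at≡nth : ∀ w i → at w i ≡ nth l0 w i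
at≡nth []      i       = refl
at≡nth (c ∷ w) zero    = refl
at≡nth (c ∷ w) (suc i) = at≡nth w i

nth-++ˡ : {A : Set} (a : A) (u v : List A) {i : ℕ} → i < length u → nth a (u ++ v) i ≡ nth a u i
nth-++ˡ a (c ∷ u) v {zero}  _         = refl
nth-++ˡ a (c ∷ u) v {suc i} (s≤s i<u) = nth-++ˡ a u v i<u

-- Positions are written toℕ d + q * 3 (offset d in block q), as in Data.Nat.DivMod; then
-- suc (2 + q * 3) is definitionally 0 + suc q * 3.
nth-concatMap-tabulate : {A B : Set} (a : A) (b : B) (h : B → Fin 3 → A) (w : List B) {q : ℕ} (d : Fin 3) →
  q < length w → nth a (concatMap (tabulate ∘ h) w) (toℕ d + q * 3) ≡ h (nth b w q) d
nth-concatMap-tabulate a b h (X ∷ w) {zero}  0F _         = refl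
nth-concatMap-tabulate a b h (X ∷ w) {zero}  1F _         = refl
nth-concatMap-tabulate a b h (X ∷ w) {zero}  2F _         = refl
nth-concatMap-tabulate a b h (X ∷ w) {suc q} 0F (s≤s q<w) = nth-concatMap-tabulate a b h w 0F q<w
nth-concatMap-tabulate a b h (X ∷ w) {suc q} 1F (s≤s q<w) = nth-concatMap-tabulate a b h w 1F q<w
nth-concatMap-tabulate a b h (X ∷ w) {suc q} 2F (s≤s q<w) = nth-concatMap-tabulate a b h w 2F q<w

nth-Linked : {A : Set} {R : A → A → Set} (a : A) {w : List A} {q : ℕ} →
  Linked R w → suc q < length w → R (nth a w q) (nth a w (suc q))
nth-Linked a [-]                    (s≤s ())
nth-Linked a {q = zero}  (r ∷ _)  _         = r
nth-Linked a {q = suc q} (_ ∷ rs) (s≤s q<w) = nth-Linked a rs q<w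

-- Weights of factors

length-factor : ∀ (y : ℕ → Letter) i n → length (factor y i n) ≡ n
length-factor y i n = trans (length-map _ (upTo n)) (length-upTo n)

factor-suc : ∀ (y : ℕ → Letter) i n → factor y i (suc n) ≡ y i ∷ factor y (suc i) n
factor-suc y i n = cong₂ _∷_ (cong y (+-identityʳ i)) (begin
  map g (applyUpTo suc n)               ≡⟨ map-applyUpTo suc g n ⟩
  applyUpTo (g ∘ suc) n                 ≡⟨ map-upTo (g ∘ suc) n ⟨
  map (g ∘ suc) (upTo n)                ≡⟨ map-cong (λ j → cong y (+-suc i j)) (upTo n) ⟩
  map (λ j → y (suc i + j)) (upTo n)    ∎)
  where
  open ≡-Reasoning
  g = λ j → y (i + j)

weight-telescope : ∀ (y : ℕ → Letter) (p : ℕ → ℕ) → (∀ j → toℕ (y j) + p j ≡ suc (p (suc j))) →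
  ∀ n i → weight (factor y i n) + p i ≡ n + p (i + n)
weight-telescope y p step zero    i = cong p (sym (+-identityʳ i))
weight-telescope y p step (suc n) i = begin
  weight (factor y i (suc n)) + p i   ≡⟨ cong (λ w → weight w + p i) (factor-suc y i n) ⟩
  (toℕ (y i) + w) + p i               ≡⟨ cong (_+ p i) (+-comm (toℕ (y i)) w) ⟩
  (w + toℕ (y i)) + p i               ≡⟨ +-assoc w (toℕ (y i)) (p i) ⟩
  w + (toℕ (y i) + p i)               ≡⟨ cong (w +_) (step i) ⟩
  w + suc (p (suc i))                 ≡⟨ +-suc w (p (suc i)) ⟩
  suc (w + p (suc i))                 ≡⟨ cong suc (weight-telescope y p step n (suc i)) ⟩
  suc (n + p (suc i + n))             ≡⟨ cong (λ k → suc n + p k) (+-suc i n) ⟨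
  suc n + p (i + suc n)               ∎
  where
  open ≡-Reasoning
  w = weight (factor y (suc i) n)

rhoAdd-byWeights : ∀ {y n} (ws : List ℕ) → Unique ws →
  All (λ w → ∃ λ i → weight (factor y i n) ≡ w) ws →
  (∀ i → weight (factor y i n) ∈ ws) →
  RhoAdd y n (length ws)
rhoAdd-byWeights {y} {n} ws unique realised covered =
  map fac ps , count , lengths , factors , distinct , complete
  where
  fac : ℕ → Word
  fac i = factor y i n
  wt : ℕ → ℕ
  wt i = weight (fac i)
  ps : List ℕ
  ps = All.reduce proj₁ realised
  weights : ∀ {vs} (rs : All (λ w → ∃ λ i → wt i ≡ w) vs) → map wt (All.reduce proj₁ rs) ≡ vs
  weights []              = refl
  weights ((i , eq) ∷ rs) = cong₂ _∷_ eq (weights rs)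
  count : length (map fac ps) ≡ length ws
  count = trans (length-map fac ps) (trans (sym (length-map wt ps)) (cong length (weights realised)))
  lengths : All (λ u → length u ≡ n) (map fac ps)
  lengths = All.map⁺ (All.universal (λ i → length-factor y i n) ps)
  factors : All (IsFactor y) (map fac ps)
  factors = All.map⁺ (All.universal (λ i → i , cong (factor y i) (sym (length-factor y i n))) ps)
  distinct : AllPairs.AllPairs (λ u v → ¬ AddEq u v) (map fac ps)
  distinct = AllPairs.map⁺ (AllPairs.map (λ wt≢ → wt≢ ∘ proj₂)
               (AllPairs.map⁻ (subst Unique (sym (weights realised)) unique)))
  complete : ∀ w → length w ≡ n → IsFactor y w → Any (AddEq w) (map fac ps)
  complete w len (i , w≡) = subst (λ u → Any (AddEq u) (map fac ps)) (sym (trans w≡ (cong (factor y i) len)))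
    (Any.map⁺ (Any.map (λ {j} eq → trans (length-factor y i n) (sym (length-factor y j n)) , eq)
      (Any.map⁻ (subst (wt i ∈_) (sym (weights realised)) (covered i)))))

rhoAdd-interval : ∀ y {n} k t →
  All (λ s → ∃ λ i → weight (factor y i n) ≡ k + s) (upTo t) →
  (∀ i → weight (factor y i n) ∈ map (k +_) (upTo t)) →
  RhoAdd y n t
rhoAdd-interval y {n} k t realised covered =
  subst (RhoAdd y n) (trans (length-map (k +_) (upTo t)) (length-upTo t))
    (rhoAdd-byWeights {y} (map (k +_) (upTo t)) (Unique.map⁺ (+-cancelˡ-≡ k _ _) (Unique.upTo⁺ t))
      (All.map⁺ realised) covered)

cancel-potential : ∀ {w a c} j k → w + a ≡ j + k + c → a ≤ j + c → w ≡ k + (j + c ∸ a)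
cancel-potential {w} {a} {c} j k eq a≤ = +-cancelʳ-≡ a w (k + (j + c ∸ a)) (begin
  w + a                    ≡⟨ eq ⟩
  j + k + c                ≡⟨ shuffle j k c ⟩
  k + (j + c)              ≡⟨ cong (k +_) (m∸n+n≡m a≤) ⟨
  k + ((j + c ∸ a) + a)    ≡⟨ +-assoc k (j + c ∸ a) a ⟨
  k + (j + c ∸ a) + a      ∎)
  where
  open ≡-Reasoning
  shuffle : ∀ j k c → j + k + c ≡ k + (j + c)
  shuffle = solve-∀

window : ∀ {w a c} j k t → w + a ≡ j + k + c → a ≤ j + c → j + c < t + a → w ∈ map (k +_) (upTo t)
window {a = a} {c} j k t eq a≤ <t+a =
  subst (_∈ map (k +_) (upTo t)) (sym (cancel-potential j k eq a≤))
    (∈-map⁺ (k +_) (∈-upTo⁺ (subst (j + c ∸ a <_) (m+n∸n≡m t a) (∸-monoˡ-< <t+a a≤))))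

positional-shift : ∀ a a′ n Q q → a + n ≡ a′ + Q * 3 → a + q * 3 + n ≡ a′ + (q + Q) * 3
positional-shift a a′ n Q q eq = begin
  a + q * 3 + n        ≡⟨ swap a (q * 3) n ⟩
  a + n + q * 3        ≡⟨ cong (_+ q * 3) eq ⟩
  a′ + Q * 3 + q * 3   ≡⟨ collect a′ Q q ⟩
  a′ + (q + Q) * 3     ∎
  where
  open ≡-Reasoning
  swap : ∀ a m n → a + m + n ≡ a + n + m
  swap = solve-∀
  collect : ∀ a Q q → a + Q * 3 + q * 3 ≡ a + (q + Q) * 3
  collect = solve-∀

[d+q*3]%3≡d : ∀ (d : Fin 3) q → (toℕ d + q * 3) % 3 ≡ toℕ d
[d+q*3]%3≡d d q = trans ([m+kn]%n≡m%n (toℕ d) q 3) (m<n⇒m%n≡m (toℕ<n d))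

-- Blocks

data Block : Set where
  A B C : Block

_≟_ : DecidableEquality Block
A ≟ A = yes refl
A ≟ B = no λ ()
A ≟ C = no λ ()
B ≟ A = no λ ()
B ≟ B = yes refl
B ≟ C = no λ ()
C ≟ A = no λ ()
C ≟ B = no λ ()
C ≟ C = yes refl

∀-Block? : {P : Block → Set} → (∀ X → Dec (P X)) → Dec (∀ X → P X)
∀-Block? P? = map′ (λ { (pA , pB , pC) A → pA ; (pA , pB , pC) B → pB ; (pA , pB , pC) C → pC })
                   (λ p → p A , p B , p C)
                   (P? A ×-dec P? B ×-dec P? C)

σ : Block → Fin 3 → Block
σ A 0F = A
σ A 1F = B
σ A 2F = C
σ B 0F = B
σ B 1F = C
σ B 2F = B
σ C 0F = C
σ C 1F = A
σ C 2F = A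

σ-0 : ∀ X → σ X 0F ≡ X
σ-0 A = refl
σ-0 B = refl
σ-0 C = refl

σ-surjective : ∀ e Y → ∃ λ Y′ → σ Y′ e ≡ Y
σ-surjective 0F Y = Y , σ-0 Y
σ-surjective 1F A = C , refl
σ-surjective 1F B = A , refl
σ-surjective 1F C = B , refl
σ-surjective 2F A = C , refl
σ-surjective 2F B = B , refl
σ-surjective 2F C = A , refl

letter : Block → Fin 3 → Letter
letter A 0F = l0
letter A 1F = l1
letter A 2F = l2
letter B 0F = l1
letter B 1F = l1
letter B 2F = l2
letter C 0F = l0
letter C 1F = l0
letter C 2F = l2

σ* : List Block → List Block
σ* = concatMap (tabulate ∘ σ)

letters : List Block → Word
letters = concatMap (tabulate ∘ letter)

L : ℕ → List Block
L zero    = A ∷ []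
L (suc K) = σ* (L K)

b : ℕ → Block
b k = nth A (L k) k

length-σ* : ∀ w → length (σ* w) ≡ 3 * length w
length-σ* []      = refl
length-σ* (X ∷ w) = trans (cong (3 +_) (length-σ* w)) (sym (*-suc 3 (length w)))

<length-L : ∀ K → K < length (L K)
<length-L zero    = s≤s z≤n
<length-L (suc K) = begin-strict
  suc K              <⟨ +-mono-≤ (≤-trans (s≤s z≤n) K<ℓ) K<ℓ ⟩
  ℓ + ℓ              ≤⟨ +-monoʳ-≤ ℓ (m≤m+n ℓ (ℓ + 0)) ⟩
  3 * ℓ              ≡⟨ length-σ* (L K) ⟨
  length (L (suc K)) ∎
  where
  open ≤-Reasoning
  ℓ = length (L K)
  K<ℓ = <length-L K

digits<length-L : ∀ q (d : Fin 3) → toℕ d + q * 3 < length (L (suc q))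
digits<length-L q d = begin-strict
  toℕ d + q * 3        <⟨ +-monoˡ-< (q * 3) (toℕ<n d) ⟩
  suc q * 3            ≤⟨ *-monoˡ-≤ 3 (<length-L q) ⟩
  length (L q) * 3     ≡⟨ *-comm (length (L q)) 3 ⟩
  3 * length (L q)     ≡⟨ length-σ* (L q) ⟨
  length (L (suc q))   ∎
  where open ≤-Reasoning

L-prefix : ∀ {K K′} → K ≤ K′ → ∃ λ t → L K′ ≡ L K ++ t
L-prefix {K′ = zero}   z≤n = [] , refl
L-prefix {K′ = suc K′} z≤n with t , eq ← L-prefix {K′ = K′} z≤n = B ∷ C ∷ σ* t , cong σ* eq
L-prefix {suc K} (s≤s K≤K′) with t , eq ← L-prefix K≤K′ =
  σ* t , trans (cong σ* eq) (concatMap-++ (tabulate ∘ σ) (L K) t)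

nth-L-stable : ∀ {K K′ q} → K ≤ K′ → q < length (L K) → nth A (L K′) q ≡ nth A (L K) q
nth-L-stable {K} {q = q} K≤K′ q<ℓ with t , eq ← L-prefix K≤K′ =
  trans (cong (λ w → nth A w q) eq) (nth-++ˡ A (L K) t q<ℓ)

b-prefix : ∀ K {q} → q < length (L K) → nth A (L K) q ≡ b q
b-prefix K {q} q<ℓ with ≤-total K q
... | inj₁ K≤q = sym (nth-L-stable K≤q q<ℓ)
... | inj₂ q≤K = nth-L-stable q≤K (<length-L q)

b-σ : ∀ q d → b (toℕ d + q * 3) ≡ σ (b q) d
b-σ q d = trans (sym (b-prefix (suc q) (digits<length-L q d)))
                (nth-concatMap-tabulate A A σ (L q) d (<length-L q))

data Good : List Block → Set where
  []   : Good []
  A∷_  : ∀ {w} → Good w → Good (A ∷ w)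
  BC∷_ : ∀ {w} → Good w → Good (B ∷ C ∷ w)

Good-σ* : ∀ {w} → Good w → Good (σ* w)
Good-σ* []      = []
Good-σ* (A∷ g)  = A∷ BC∷ Good-σ* g
Good-σ* (BC∷ g) = BC∷ BC∷ A∷ A∷ Good-σ* g

Good-L : ∀ K → Good (L K)
Good-L zero    = A∷ []
Good-L (suc K) = Good-σ* (Good-L K)

f*-letters : ∀ {w} → Good w → f* (letters w) ≡ letters (σ* w)
f*-letters []      = refl
f*-letters (A∷ g)  = cong (letters (σ* (A ∷ [])) ++_) (f*-letters g)
f*-letters (BC∷ g) = cong (letters (σ* (B ∷ C ∷ [])) ++_) (f*-letters g)

fpow-L : ∀ K → fpow (suc K) ≡ letters (L K)
fpow-L zero    = refl
fpow-L (suc K) = trans (cong f* (fpow-L K)) (f*-letters (Good-L K))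

x-digits : ∀ q d → x (toℕ d + q * 3) ≡ letter (b q) d
x-digits q d = begin
  at (fpow (suc j)) j         ≡⟨ at≡nth (fpow (suc j)) j ⟩
  nth l0 (fpow (suc j)) j     ≡⟨ cong (λ w → nth l0 w j) (fpow-L j) ⟩
  nth l0 (letters (L j)) j    ≡⟨ nth-concatMap-tabulate l0 A letter (L j) d q<ℓ ⟩
  letter (nth A (L j) q) d    ≡⟨ cong (λ X → letter X d) (b-prefix j q<ℓ) ⟩
  letter (b q) d              ∎
  where
  open ≡-Reasoning
  j = toℕ d + q * 3
  q<ℓ : q < length (L j)
  q<ℓ = ≤-<-trans (≤-trans (m≤m*n q 3) (m≤n+m (q * 3) (toℕ d))) (<length-L j)

data _⇝_ : Block → Block → Set where
  A⇝A : A ⇝ A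
  A⇝B : A ⇝ B
  B⇝C : B ⇝ C
  C⇝A : C ⇝ A
  C⇝B : C ⇝ B

Good⇒Linked : ∀ {w} → Good w → Linked _⇝_ w
Good⇒Linked []          = []
Good⇒Linked (A∷ [])     = [-]
Good⇒Linked (A∷ A∷ g)   = A⇝A ∷ Good⇒Linked (A∷ g)
Good⇒Linked (A∷ BC∷ g)  = A⇝B ∷ Good⇒Linked (BC∷ g)
Good⇒Linked (BC∷ [])    = B⇝C ∷ [-]
Good⇒Linked (BC∷ A∷ g)  = B⇝C ∷ C⇝A ∷ Good⇒Linked (A∷ g)
Good⇒Linked (BC∷ BC∷ g) = B⇝C ∷ C⇝B ∷ Good⇒Linked (BC∷ g)

b-⇝ : ∀ q → b q ⇝ b (suc q)
b-⇝ q = subst₂ _⇝_ (b-prefix (suc q) (<-trans (n<1+n q) (<length-L (suc q))))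
                   (b-prefix (suc q) (<length-L (suc q)))
                   (nth-Linked A (Good⇒Linked (Good-L (suc q))) (<length-L (suc q)))

-- potential j = 1 + Σ_{i<j} (x_i − 1), tabulated by block and offset; a C-block starts at
-- level 2 because it always follows a B-block, which raises the sum by one.
level : Block → Fin 3 → ℕ
level A 0F = 1
level A 1F = 0
level A 2F = 0
level B 0F = 1
level B 1F = 1
level B 2F = 1
level C 0F = 2
level C 1F = 1
level C 2F = 0

level-within : ∀ X → toℕ (letter X 0F) + level X 0F ≡ suc (level X 1F)
                   × toℕ (letter X 1F) + level X 1F ≡ suc (level X 2F)
level-within A = refl , refl
level-within B = refl , refl
level-within C = refl , refl

level-across : ∀ {X Y} → X ⇝ Y → toℕ (letter X 2F) + level X 2F ≡ suc (level Y 0F)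
level-across A⇝A = refl
level-across A⇝B = refl
level-across B⇝C = refl
level-across C⇝A = refl
level-across C⇝B = refl

lowest : Fin 3 → ℕ
lowest 0F = 1
lowest 1F = 0
lowest 2F = 0

level-range : ∀ X d → lowest d ≤ level X d × level X d ≤ suc (lowest d)
level-range = toWitness {a? = ∀-Block? λ X → all? λ d → (lowest d ≤? level X d) ×-dec (level X d ≤? suc (lowest d))} _

level-spread : ∀ d X Y → level X d ≤ suc (level Y d)
level-spread d X Y = ≤-trans (proj₂ (level-range X d)) (s≤s (proj₁ (level-range Y d)))

level≤2 : ∀ X d → level X d ≤ 2
level≤2 X d = ≤-trans (proj₂ (level-range X d)) (s≤s (lowest≤1 d))
  where
  lowest≤1 : ∀ d → lowest d ≤ 1
  lowest≤1 0F = ≤-refl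
  lowest≤1 1F = z≤n
  lowest≤1 2F = z≤n

potential : ℕ → ℕ
potential j = level (b (j / 3)) (j mod 3)

potential-digits : ∀ q d → potential (toℕ d + q * 3) ≡ level (b q) d
potential-digits q d = cong₂ (λ q′ d′ → level (b q′) d′) quotient remainder
  where
  quotient : (toℕ d + q * 3) / 3 ≡ q
  quotient = trans (+-distrib-/-∣ʳ (toℕ d) (n∣m*n q))
                   (cong₂ _+_ (m<n⇒m/n≡0 (toℕ<n d)) (m*n/n≡m q 3))
  remainder : (toℕ d + q * 3) mod 3 ≡ d
  remainder = toℕ-injective (trans (toℕ-fromℕ< _) ([d+q*3]%3≡d d q))

potential-step : ∀ j → toℕ (x j) + potential j ≡ suc (potential (suc j))
potential-step j with result q d refl ← j divMod 3 = begin
  toℕ (x (toℕ d + q * 3)) + potential (toℕ d + q * 3)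
    ≡⟨ cong₂ _+_ (cong toℕ (x-digits q d)) (potential-digits q d) ⟩
  toℕ (letter (b q) d) + level (b q) d
    ≡⟨ within-or-across d ⟩
  suc (potential (suc (toℕ d + q * 3)))
    ∎
  where
  open ≡-Reasoning
  within-or-across : ∀ d → toℕ (letter (b q) d) + level (b q) d ≡ suc (potential (suc (toℕ d + q * 3)))
  within-or-across 0F = trans (proj₁ (level-within (b q))) (cong suc (sym (potential-digits q 1F)))
  within-or-across 1F = trans (proj₂ (level-within (b q))) (cong suc (sym (potential-digits q 2F)))
  within-or-across 2F = trans (level-across (b-⇝ q)) (cong suc (sym (potential-digits (suc q) 0F)))

weight-potential : ∀ n i → weight (factor x i n) + potential i ≡ n + potential (i + n)
weight-potential = weight-telescope x potential potential-step

weight-between : ∀ q d d′ {n Q} → toℕ d + n ≡ toℕ d′ + Q * 3 →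
  weight (factor x (toℕ d + q * 3) n) + level (b q) d ≡ n + level (b (q + Q)) d′
weight-between q d d′ {n} {Q} eq = begin
  w + level (b q) d                     ≡⟨ cong (w +_) (potential-digits q d) ⟨
  w + potential i                       ≡⟨ weight-potential n i ⟩
  n + potential (i + n)                 ≡⟨ cong (λ j → n + potential j) (positional-shift (toℕ d) (toℕ d′) n Q q eq) ⟩
  n + potential (toℕ d′ + (q + Q) * 3)  ≡⟨ cong (n +_) (potential-digits (q + Q) d′) ⟩
  n + level (b (q + Q)) d′              ∎
  where
  open ≡-Reasoning
  i = toℕ d + q * 3
  w = weight (factor x i n)

weight∈n±1 : ∀ m i → weight (factor x i (suc m * 3)) ∈ map ((2 + m * 3) +_) (upTo 3)
weight∈n±1 m i with result q d refl ← i divMod 3 =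
  window 1 (2 + m * 3) 3 (weight-between q d d {Q = suc m} refl)
    (level-spread d _ _) (s≤s (s≤s (level-spread d _ _)))

weight∈n±2 : ∀ k i → weight (factor x i (2 + k)) ∈ map (k +_) (upTo 5)
weight∈n±2 k i = window 2 k 5 (weight-potential (2 + k) i)
  (≤-trans (potential≤2 i) (m≤m+n 2 _)) (s≤s (s≤s (s≤s (≤-trans (potential≤2 (i + (2 + k))) (m≤m+n 2 _)))))
  where
  potential≤2 : ∀ j → potential j ≤ 2
  potential≤2 j = level≤2 (b (j / 3)) (j mod 3)

-- Pairs of blocks at a given distance

PairAt : ℕ → Block → Block → Set
PairAt j X Y = ∃ λ k → b k ≡ X × b (k + j) ≡ Y

PairAt-σ : ∀ {Q X Y} → PairAt Q X Y → ∀ e → PairAt (toℕ e + Q * 3) X (σ Y e)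
PairAt-σ {Q} {X} {Y} (k , bk≡X , bk+Q≡Y) e = k * 3 , start , end
  where
  start : b (k * 3) ≡ X
  start = trans (b-σ k 0F) (trans (σ-0 (b k)) bk≡X)
  end : b (k * 3 + (toℕ e + Q * 3)) ≡ σ Y e
  end = trans (cong b (positional-shift 0 (toℕ e) (toℕ e + Q * 3) Q k refl))
              (trans (b-σ (k + Q) e) (cong (λ Z → σ Z e) bk+Q≡Y))

PairsFrom : Block → Set
PairsFrom X = ∀ j → 2 ≤ j → ∀ Y → PairAt j X Y

PairsFrom-byBase : ∀ X → (∀ {j} → j < 6 → 2 ≤ j → ∀ Y → PairAt j X Y) → PairsFrom X
PairsFrom-byBase X base = <-rec _ go
  where
  step : ∀ Q e → (∀ {i} → i < toℕ e + Q * 3 → 2 ≤ i → ∀ Y → PairAt i X Y) →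
         2 ≤ toℕ e + Q * 3 → ∀ Y → PairAt (toℕ e + Q * 3) X Y
  step 0 e _ = base (+-mono-<-≤ (toℕ<n e) z≤n)
  step 1 e _ = base (+-mono-<-≤ (toℕ<n e) ≤-refl)
  step Q@(suc (suc _)) e rec _ Y =
    let Y′ , σY′≡Y = σ-surjective e Y in
    subst (PairAt (toℕ e + Q * 3) X) σY′≡Y (PairAt-σ (rec Q<j (s≤s (s≤s z≤n)) Y′) e)
    where
    Q<j : Q < toℕ e + Q * 3
    Q<j = <-≤-trans (m<m*n Q 3 (s≤s (s≤s z≤n))) (m≤n+m (Q * 3) (toℕ e))
  go : ∀ j → (∀ {i} → i < j → 2 ≤ i → ∀ Y → PairAt i X Y) → 2 ≤ j → ∀ Y → PairAt j X Y
  go j rec with result Q e refl ← j divMod 3 = step Q e rec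

PairInPrefix : ℕ → Block → Block → ℕ → Set
PairInPrefix j X Y k = k + j < length (L 4) × nth A (L 4) k ≡ X × nth A (L 4) (k + j) ≡ Y

pairInPrefix? : ∀ j X Y → Dec (∃ λ k → k < length (L 4) × PairInPrefix j X Y k)
pairInPrefix? j X Y = anyUpTo?
  (λ k → (k + j <? length (L 4)) ×-dec (nth A (L 4) k ≟ X) ×-dec (nth A (L 4) (k + j) ≟ Y))
  (length (L 4))

PairInPrefix⇒PairAt : ∀ {j X Y k} → PairInPrefix j X Y k → PairAt j X Y
PairInPrefix⇒PairAt {j} {k = k} (k+j<ℓ , bk≡X , bk+j≡Y) =
  k , trans (sym (b-prefix 4 (≤-<-trans (m≤m+n k j) k+j<ℓ))) bk≡X , trans (sym (b-prefix 4 k+j<ℓ)) bk+j≡Y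

occurs : ∀ {j X Y} → True (pairInPrefix? j X Y) → PairAt j X Y
occurs found = PairInPrefix⇒PairAt (proj₂ (proj₂ (toWitness found)))

smallPairs? : ∀ X → Dec (∀ {j} → j < 6 → 2 ≤ j → ∀ Y → ∃ λ k → k < length (L 4) × PairInPrefix j X Y k)
smallPairs? X = allUpTo? (λ j → (2 ≤? j) →-dec ∀-Block? (pairInPrefix? j X)) 6

PairsFrom-byComputation : ∀ X → True (smallPairs? X) → PairsFrom X
PairsFrom-byComputation X found = PairsFrom-byBase X λ j<6 2≤j Y →
  PairInPrefix⇒PairAt (proj₂ (proj₂ (toWitness found j<6 2≤j Y)))

A-pairs : PairsFrom A
A-pairs = PairsFrom-byComputation A _

C-pairs : PairsFrom C
C-pairs = PairsFrom-byComputation C _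

⇝-occurs : ∀ {X Y} → X ⇝ Y → PairAt 1 X Y
⇝-occurs A⇝A = occurs _
⇝-occurs A⇝B = occurs _
⇝-occurs B⇝C = occurs _
⇝-occurs C⇝A = occurs _
⇝-occurs C⇝B = occurs _

PairAt-near : ∀ {X Y} → PairsFrom X → X ⇝ Y → ∀ m → PairAt (suc m) X Y
PairAt-near _   X⇝Y zero    = ⇝-occurs X⇝Y
PairAt-near far _   (suc m) = far (suc (suc m)) (s≤s (s≤s z≤n)) _

weight-fromPair : ∀ {Q X Y} → PairAt Q X Y → ∀ d d′ {n} → toℕ d + n ≡ toℕ d′ + Q * 3 →
  ∃ λ i → weight (factor x i n) + level X d ≡ n + level Y d′
weight-fromPair (k , refl , refl) d d′ eq = toℕ d + k * 3 , weight-between k d d′ eq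

weight-fromPair₁ : ∀ k {Q X Y} d → PairAt Q X Y → toℕ d + (1 + k) ≡ toℕ d + Q * 3 →
  ∃ λ i → weight (factor x i (1 + k)) ≡ k + (1 + level Y d ∸ level X d)
weight-fromPair₁ k {X = X} {Y} d p eq with i , eq′ ← weight-fromPair p d d eq =
  i , cancel-potential 1 k eq′ (level-spread d X Y)

weight-fromPair₂ : ∀ k {Q X Y} d d′ → PairAt Q X Y → toℕ d + (2 + k) ≡ toℕ d′ + Q * 3 →
  ∃ λ i → weight (factor x i (2 + k)) ≡ k + (2 + level Y d′ ∸ level X d)
weight-fromPair₂ k {X = X} d d′ p eq with i , eq′ ← weight-fromPair p d d′ eq =
  i , cancel-potential 2 k eq′ (≤-trans (level≤2 X d) (m≤m+n 2 _))

weight-one : ∀ i → weight (factor x i 1) ≡ toℕ (x i)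
weight-one i = trans (cong weight (factor-suc x i 0)) (+-identityʳ (toℕ (x i)))

weight-two : ∀ i → weight (factor x i 2) ≡ toℕ (x i) + toℕ (x (suc i))
weight-two i = trans (cong weight (factor-suc x i 1)) (cong (toℕ (x i) +_) (weight-one (suc i)))

letter≤1 : ∀ X → toℕ (letter X 0F) ≤ 1 × toℕ (letter X 1F) ≤ 1
letter≤1 A = z≤n , ≤-refl
letter≤1 B = ≤-refl , ≤-refl
letter≤1 C = z≤n , z≤n

adjacent-weight<4 : ∀ i → toℕ (x i) + toℕ (x (suc i)) < 4
adjacent-weight<4 i with result q d refl ← i divMod 3 = bound d
  where
  ≤2 : ∀ j → toℕ (x j) ≤ 2
  ≤2 j = s≤s⁻¹ (toℕ<n (x j))
  early : ∀ q d → toℕ (letter (b q) d) ≤ 1 → toℕ (x (toℕ d + q * 3)) ≤ 1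
  early q d = subst (λ a → toℕ a ≤ 1) (sym (x-digits q d))
  bound : ∀ d → toℕ (x (toℕ d + q * 3)) + toℕ (x (suc (toℕ d + q * 3))) < 4
  bound 0F = s≤s (+-mono-≤ (early q 0F (proj₁ (letter≤1 (b q)))) (≤2 (1 + q * 3)))
  bound 1F = s≤s (+-mono-≤ (early q 1F (proj₂ (letter≤1 (b q)))) (≤2 (2 + q * 3)))
  bound 2F = s≤s (+-mono-≤ (≤2 (2 + q * 3)) (early (suc q) 0F (proj₁ (letter≤1 (b (suc q))))))

rhoAdd-length0 : RhoAdd x 0 1
rhoAdd-length0 = rhoAdd-interval x 0 1 ((0 , refl) ∷ []) (λ _ → here refl)

rhoAdd-length1 : RhoAdd x 1 3
rhoAdd-length1 = rhoAdd-interval x 0 3 ((0 , refl) ∷ (1 , refl) ∷ (2 , refl) ∷ [])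
  (λ i → ∈-upTo⁺ (subst (_< 3) (sym (weight-one i)) (toℕ<n (x i))))

rhoAdd-length2 : RhoAdd x 2 4
rhoAdd-length2 = rhoAdd-interval x 0 4 ((6 , refl) ∷ (0 , refl) ∷ (3 , refl) ∷ (1 , refl) ∷ [])
  (λ i → ∈-upTo⁺ (subst (_< 4) (sym (weight-two i)) (adjacent-weight<4 i)))

rhoAdd-0mod3 : ∀ m → RhoAdd x (suc m * 3) 3
rhoAdd-0mod3 m = rhoAdd-interval x k 3
  ( weight-fromPair₁ k 0F (PairAt-near C-pairs C⇝A m) refl
  ∷ weight-fromPair₁ k 0F (PairAt-near A-pairs A⇝A m) refl
  ∷ weight-fromPair₁ k 1F (PairAt-near A-pairs A⇝B m) refl
  ∷ [])
  (weight∈n±1 m)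
  where
  k = 2 + m * 3

rhoAdd-1mod3 : ∀ m → RhoAdd x (1 + suc m * 3) 5
rhoAdd-1mod3 m = rhoAdd-interval x k 5
  ( weight-fromPair₂ k 0F 1F (PairAt-near C-pairs C⇝A m) refl
  ∷ weight-fromPair₂ k 0F 1F (PairAt-near A-pairs A⇝A m) refl
  ∷ weight-fromPair₂ k 0F 1F (PairAt-near A-pairs A⇝B m) refl
  ∷ weight-fromPair₂ k 1F 2F (PairAt-near A-pairs A⇝B m) refl
  ∷ weight-fromPair₂ k 2F 0F (A-pairs (2 + m) (s≤s (s≤s z≤n)) C) refl
  ∷ [])
  (weight∈n±2 k)
  where
  k = 2 + m * 3

rhoAdd-2mod3 : ∀ m → RhoAdd x (2 + suc m * 3) 5
rhoAdd-2mod3 m = rhoAdd-interval x k 5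
  ( weight-fromPair₂ k 0F 2F (PairAt-near C-pairs C⇝A m) refl
  ∷ weight-fromPair₂ k 0F 2F (PairAt-near C-pairs C⇝B m) refl
  ∷ weight-fromPair₂ k 0F 2F (PairAt-near A-pairs A⇝B m) refl
  ∷ weight-fromPair₂ k 1F 0F (A-pairs (2 + m) (s≤s (s≤s z≤n)) A) refl
  ∷ weight-fromPair₂ k 1F 0F (A-pairs (2 + m) (s≤s (s≤s z≤n)) C) refl
  ∷ [])
  (weight∈n±2 k)
  where
  k = 3 + m * 3

rhoAdd-≥3 : ∀ n → 3 ≤ n → (n % 3 ≡ 0 → RhoAdd x n 3) × (¬ (n % 3 ≡ 0) → RhoAdd x n 5)
rhoAdd-≥3 n 3≤n with n divMod 3
... | result zero    e  refl = contradiction 3≤n (<⇒≱ (+-mono-<-≤ (toℕ<n e) z≤n))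
... | result (suc m) 0F refl = (λ _ → rhoAdd-0mod3 m) , contradiction ([d+q*3]%3≡d 0F (suc m))
... | result (suc m) 1F refl =
  (λ ≡0 → contradiction (trans (sym ([d+q*3]%3≡d 1F (suc m))) ≡0) λ ()) , (λ _ → rhoAdd-1mod3 m)
... | result (suc m) 2F refl =
  (λ ≡0 → contradiction (trans (sym ([d+q*3]%3≡d 2F (suc m))) ≡0) λ ()) , (λ _ → rhoAdd-2mod3 m)

proposition3p11 : RhoAdd x 0 1 × RhoAdd x 1 3 × RhoAdd x 2 4
    × (∀ n → 3 ≤ n → (n % 3 ≡ 0 → RhoAdd x n 3) × (¬ (n % 3 ≡ 0) → RhoAdd x n 5))
proposition3p11 = rhoAdd-length0 , rhoAdd-length1 , rhoAdd-length2 , rhoAdd-≥3
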